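{- Suppose that (KCI) holds. Then, for all $(a_i)_{i\in I}$, the left and right negations on the kite algebra $K$ are as follows: (LN) $((a_i)_{i\in I})^{ - }=(\eta a_{\rho i})_{i\in I}$ and $((\eta a_i)_{i\in I})^{ - }=(a_{\lambda^{ -1}i})_{i\in I}$; (RN) $((a_i)_{i\in I})^{\sim}=(\eta a_{\lambda i})_{i\in I}$ and $((\eta a_i)_{i\in I})^{\sim}=(a_{\rho^{ -1}i})_{i\in I}$; and from (LN), $((a_i)_{i\in I})^{ -- }=(a_{\rho\lambda^{ -1}i})_{i\in I}=\gamma(a_i)_{i\in I}$. Therefore, $(K;+,0_K,1_K)$ is a (binary) unitization of $P^I$ with $\gamma$ as its unitizing PEA-automorphism.
   Context: $(P;\oplus,0)$ is a GPEA (partial operation $\oplus$ with constant $0$: associative in the partial sense, conjugation $a\oplus b=c\oplus a=b\oplus d$ for some $c,d$, two-sided cancellation, neutral $0$, positivity). Order: $a\le b$ iff $a\oplus c=b$ for some $c$; for $a\le b$, $a/b$ is the unique $c$ with $a\oplus c=b$ and $b\backslash a$ the unique $d$ with $d\oplus a=b$. $I$ is a nonempty index set, $\lambda,\rho\colon I\to I$ bijections, $P^I$ the coordinatewise GPEA. $P^\eta$ is disjoint from $P$ with a bijection $\eta\colon P\to P^\eta$. $K:=P^I\cup(P^\eta)^I$, $0_K:=0^I$, $1_K:=(\eta0)_{i\in I}$, with $+$: (K1) $(a_i)+(b_i)=(a_i\oplus b_i)$ iff all defined; (K2) $(a_i)+(\eta b_i)=(\eta(b_i\backslash a_{\lambda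 i}))$ iff $a_{\lambda i}\le b_i$ for all $i$; (K3) $(\eta a_i)+(b_i)=(\eta(b_{\rho i}/a_i))$ iff $b_{\rho i}\le a_i$ for all $i$; (K4) $(\eta a_i)+(\eta b_i)$ undefined. (KCI): for all families and all $i$, $a_{\rho i}\oplus b_i$ exists iff $b_i\oplus a_{\lambda i}$ exists. Under (KCI), $K$ is a PEA (the kite algebra). $\gamma(a_i)_{i\in I}:=(a_{\rho\lambda^{ -1}i})_{i\in I}$. In a PEA, $x^\sim$ and $x^-$ denote the unique elements with $x+x^\sim=1=x^-+x$. A (binary) unitization of a GPEA $Q$ is a PEA $V\supseteq Q$ whose sum restricts to that of $Q$ (existence included), with $1\notin Q$ and no sums of two elements of $V\setminus Q$; its unitizing automorphism is $x\mapsto x^{ -- }$ restricted to $Q$. -}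

module Defs where

open import Data.Product using (Σ; ∃; _×_; _,_; proj₁)
open import Data.Sum using (_⊎_; inj₁; inj₂)
open import Data.Empty using (⊥)
open import Data.Unit using (⊤)
open import Relation.Nullary using (¬_)
open import Relation.Binary.PropositionalEquality using (_≡_)
open import Relation.Binary using (IsEquivalence)
open import Function.Bundles using (_↔_; Inverse; _⇔_)

-- A partial binary operation ⊕ is encoded by its graph
-- Sum a b c  ("a ⊕ b is defined and equals c"); functionality is part of
-- the structure axioms below.  Equality may be a setoid equality (needed
-- for families indexed by I, since we have no function extensionality).

record PartialAlgebra : Set₁ where
  field
    Carrier : Set
    _≈_     : Carrier → Carrier → Set
    Sum     : Carrier → Carrier → Carrier → Set
    𝟎       : Carrier

mkPA : (A : Set) → (A → A → A → Set) → A → PartialAlgebra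
mkPA A S o = record { Carrier = A ; _≈_ = _≡_ ; Sum = S ; 𝟎 = o }

module _ (A : PartialAlgebra) where
  open PartialAlgebra A

  Defined : Carrier → Carrier → Set
  Defined a b = ∃ λ c → Sum a b c

  record IsPartialOperation : Set where
    field
      ≈-isEquivalence : IsEquivalence _≈_
      Sum-resp        : ∀ {a a′ b b′ c c′} → a ≈ a′ → b ≈ b′ → c ≈ c′ →
                        Sum a b c → Sum a′ b′ c′
      Sum-functional  : ∀ {a b c c′} → Sum a b c → Sum a b c′ → c ≈ c′

  record IsGPEA : Set where
    field
      isPartialOperation : IsPartialOperation
      assoc-→   : ∀ {a b c d e} → Sum a b d → Sum d c e → ∃ λ f → Sum b c f × Sum a f e
      assoc-←   : ∀ {a b c f e} → Sum b c f → Sum a f e → ∃ λ d → Sum a b d × Sum d c e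
      conjugate : ∀ {a b e} → Sum a b e → (∃ λ c → Sum c a e) × (∃ λ d → Sum b d e)
      cancelˡ   : ∀ {a b c e} → Sum a b e → Sum a c e → b ≈ c
      cancelʳ   : ∀ {a b c e} → Sum b a e → Sum c a e → b ≈ c
      identityˡ : ∀ a → Sum 𝟎 a a
      identityʳ : ∀ a → Sum a 𝟎 a
      positive  : ∀ {a b} → Sum a b 𝟎 → (a ≈ 𝟎) × (b ≈ 𝟎)

  -- Pseudo effect algebra (Dvurečenskij–Vetterlein axioms (E1)-(E4)) with top 𝟏
  record IsPEA (𝟏 : Carrier) : Set where
    field
      isPartialOperation : IsPartialOperation
      assoc-→   : ∀ {a b c d e} → Sum a b d → Sum d c e → ∃ λ f → Sum b c f × Sum a f e
      assoc-←   : ∀ {a b c f e} → Sum b c f → Sum a f e → ∃ λ d → Sum a b d × Sum d c e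
      rightComplement : ∀ a → ∃ λ d → Sum a d 𝟏 × (∀ d′ → Sum a d′ 𝟏 → d′ ≈ d)
      leftComplement  : ∀ a → ∃ λ e → Sum e a 𝟏 × (∀ e′ → Sum e′ a 𝟏 → e′ ≈ e)
      conjugate : ∀ {a b e} → Sum a b e → (∃ λ c → Sum c a e) × (∃ λ d → Sum b d e)
      one-left  : ∀ {a c} → Sum 𝟏 a c → a ≈ 𝟎
      one-right : ∀ {a c} → Sum a 𝟏 c → a ≈ 𝟎

  module _ {𝟏 : Carrier} (pea : IsPEA 𝟏) where
    _⁻ : Carrier → Carrier
    x ⁻ = proj₁ (IsPEA.leftComplement pea x)
    _∼ : Carrier → Carrier
    x ∼ = proj₁ (IsPEA.rightComplement pea x)

-- Unitization of Q by V, where Q is identified with its image under the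
-- embedding ι.

record IsUnitization (Q V : PartialAlgebra) (ι : PartialAlgebra.Carrier Q → PartialAlgebra.Carrier V)
                     (𝟏 : PartialAlgebra.Carrier V) : Set where
  private
    module Q = PartialAlgebra Q
    module V = PartialAlgebra V
  InQ : V.Carrier → Set
  InQ x = ∃ λ a → x V.≈ ι a
  field
    isPEA          : IsPEA V 𝟏
    ι-resp         : ∀ {a b} → a Q.≈ b → ι a V.≈ ι b
    ι-injective    : ∀ {a b} → ι a V.≈ ι b → a Q.≈ b
    sum-restricts  : ∀ a b c → Q.Sum a b c ⇔ V.Sum (ι a) (ι b) (ι c)
    sum-closed     : ∀ {a b z} → V.Sum (ι a) (ι b) z → InQ z
    one∉Q          : ¬ InQ 𝟏
    no-outer-sums  : ∀ {x y z} → ¬ InQ x → ¬ InQ y → ¬ V.Sum x y z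

  unitizing : V.Carrier → V.Carrier
  unitizing x = _⁻ V isPEA (_⁻ V isPEA x)

-- Kite algebra construction.  P^η is modelled as a disjoint tagged copy:
-- K = P^I ⊎ (P^η)^I, with inj₂ f standing for (η f_i)_{i ∈ I}.

module Kite (P : Set) (S : P → P → P → Set) (o : P) (I : Set) where

  PI : PartialAlgebra
  PI = record
    { Carrier = I → P
    ; _≈_ = λ a b → ∀ i → a i ≡ b i
    ; Sum = λ a b c → ∀ i → S (a i) (b i) (c i)
    ; 𝟎 = λ _ → o }

  KCarrier : Set
  KCarrier = (I → P) ⊎ (I → P)

  _≈K_ : KCarrier → KCarrier → Set
  inj₁ a ≈K inj₁ b = ∀ i → a i ≡ b i
  inj₂ a ≈K inj₂ b = ∀ i → a i ≡ b i
  inj₁ _ ≈K inj₂ _ = ⊥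
  inj₂ _ ≈K inj₁ _ = ⊥

  module _ (lam rho : I ↔ I) where
    private
      λ′ = Inverse.to lam
      ρ′ = Inverse.to rho

    SumK : KCarrier → KCarrier → KCarrier → Set
    SumK (inj₁ a) (inj₁ b) (inj₁ c) = ∀ i → S (a i) (b i) (c i)
    SumK (inj₁ a) (inj₁ b) (inj₂ c) = ⊥
    -- (K2) (a_i)+(η b_i) = (η (b_i \ a_{λ i})),  d = b \ a  iff  d ⊕ a = b
    SumK (inj₁ a) (inj₂ b) (inj₁ d) = ⊥
    SumK (inj₁ a) (inj₂ b) (inj₂ d) = ∀ i → S (d i) (a (λ′ i)) (b i)
    -- (K3) (η a_i)+(b_i) = (η (b_{ρ i} / a_i)),  c = b / a  iff  b ⊕ c = a
    SumK (inj₂ a) (inj₁ b) (inj₁ c) = ⊥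
    SumK (inj₂ a) (inj₁ b) (inj₂ c) = ∀ i → S (b (ρ′ i)) (c i) (a i)
    SumK (inj₂ a) (inj₂ b) z = ⊥

    K : PartialAlgebra
    K = record { Carrier = KCarrier ; _≈_ = _≈K_ ; Sum = SumK ; 𝟎 = inj₁ (λ _ → o) }

    oneK : KCarrier
    oneK = inj₂ (λ _ → o)

    KCI : Set
    KCI = ∀ (a b : I → P) (i : I) →
          Defined (mkPA P S o) (a (ρ′ i)) (b i) ⇔ Defined (mkPA P S o) (b i) (a (λ′ i))

    γ : (I → P) → (I → P)
    γ a i = a (ρ′ (Inverse.from lam i))

module Submission where

-- Working coordinatewise, every PEA axiom of K reduces to the
-- corresponding GPEA axiom of P, possibly after moving a coordinate along
-- one of the bijections λ, ρ (lemma `along`).  Only conjugation needs (KCI).  With these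
-- facts K is a PEA; the embedding P^I → K is the left injection, and the
-- unitization axioms are immediate from the shape of the sum (K1)-(K4).
-- Since the complements were chosen as the explicit formulas, (LN), (RN),
-- the double negation and the unitizing automorphism γ hold by
-- computation, and the main theorem merely assembles these facts.

open import Defs
open import Data.Product using (Σ; ∃; _×_; _,_; proj₁; proj₂)
open import Data.Sum using (inj₁; inj₂)
open import Data.Empty using (⊥)
open import Relation.Binary.PropositionalEquality
  using (_≡_; refl; sym; trans; cong; subst; module ≡-Reasoning)
open import Function.Bundles using (_↔_; Inverse; Equivalence; mk⇔)

module GPEAFacts (P : Set) (S : P → P → P → Set) (o : P) (G : IsGPEA (mkPA P S o)) where
  open IsGPEA G public

  functional : ∀ {a b c c′} → S a b c → S a b c′ → c ≡ c′
  functional = IsPartialOperation.Sum-functional isPartialOperation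

  plus-0ʳ : ∀ {a c} → S a o c → a ≡ c
  plus-0ʳ = functional (identityʳ _)

  plus-0ˡ : ∀ {a c} → S o a c → a ≡ c
  plus-0ˡ = functional (identityˡ _)

module KiteAlgebra (P : Set) (S : P → P → P → Set) (o : P) (G : IsGPEA (mkPA P S o))
                   (I : Set) (lam rho : I ↔ I) where
  open GPEAFacts P S o G
  open Kite P S o I
  open ≡-Reasoning

  λ′ λ⁻¹ ρ′ ρ⁻¹ : I → I
  λ′  = Inverse.to lam
  λ⁻¹ = Inverse.from lam
  ρ′  = Inverse.to rho
  ρ⁻¹ = Inverse.from rho

  λλ⁻¹ : ∀ j → λ′ (λ⁻¹ j) ≡ j
  λλ⁻¹ = Inverse.strictlyInverseˡ lam
  λ⁻¹λ : ∀ i → λ⁻¹ (λ′ i) ≡ i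
  λ⁻¹λ = Inverse.strictlyInverseʳ lam
  ρρ⁻¹ : ∀ j → ρ′ (ρ⁻¹ j) ≡ j
  ρρ⁻¹ = Inverse.strictlyInverseˡ rho
  ρ⁻¹ρ : ∀ i → ρ⁻¹ (ρ′ i) ≡ i
  ρ⁻¹ρ = Inverse.strictlyInverseʳ rho

  _+_≡_ : KCarrier → KCarrier → KCarrier → Set
  _+_≡_ = SumK lam rho

  𝟏 : KCarrier
  𝟏 = oneK lam rho

  -- A coordinatewise fact at index k is a fact at index i once k ≡ i;
  -- this is how facts are moved along λ, ρ and their inverses.
  along : (Q : I → P → Set) {k i : I} {x : P} → k ≡ i → Q k x → Q i x
  along Q {x = x} k≡i = subst (λ m → Q m x) k≡i

  ≈-refl : ∀ {x} → x ≈K x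
  ≈-refl {inj₁ a} _ = refl
  ≈-refl {inj₂ a} _ = refl

  ≈-sym : ∀ {x y} → x ≈K y → y ≈K x
  ≈-sym {inj₁ _} {inj₁ _} x≈y i = sym (x≈y i)
  ≈-sym {inj₂ _} {inj₂ _} x≈y i = sym (x≈y i)

  ≈-trans : ∀ {x y z} → x ≈K y → y ≈K z → x ≈K z
  ≈-trans {inj₁ _} {inj₁ _} {inj₁ _} x≈y y≈z i = trans (x≈y i) (y≈z i)
  ≈-trans {inj₂ _} {inj₂ _} {inj₂ _} x≈y y≈z i = trans (x≈y i) (y≈z i)

  resp-left : ∀ x x′ y z → x ≈K x′ → x + y ≡ z → x′ + y ≡ z
  resp-left (inj₁ a) (inj₁ a′) (inj₁ b) (inj₁ c) e s i = subst (λ u → S u (b i) (c i)) (e i) (s i)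
  resp-left (inj₁ a) (inj₁ a′) (inj₂ b) (inj₂ d) e s i = subst (λ u → S (d i) u (b i)) (e (λ′ i)) (s i)
  resp-left (inj₂ a) (inj₂ a′) (inj₁ b) (inj₂ c) e s i = subst (λ u → S (b (ρ′ i)) (c i) u) (e i) (s i)

  resp-middle : ∀ x y y′ z → y ≈K y′ → x + y ≡ z → x + y′ ≡ z
  resp-middle (inj₁ a) (inj₁ b) (inj₁ b′) (inj₁ c) e s i = subst (λ u → S (a i) u (c i)) (e i) (s i)
  resp-middle (inj₁ a) (inj₂ b) (inj₂ b′) (inj₂ d) e s i = subst (λ u → S (d i) (a (λ′ i)) u) (e i) (s i)
  resp-middle (inj₂ a) (inj₁ b) (inj₁ b′) (inj₂ c) e s i = subst (λ u → S u (c i) (a i)) (e (ρ′ i)) (s i)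

  resp-right : ∀ x y z z′ → z ≈K z′ → x + y ≡ z → x + y ≡ z′
  resp-right (inj₁ a) (inj₁ b) (inj₁ c) (inj₁ c′) e s i = subst (S (a i) (b i)) (e i) (s i)
  resp-right (inj₁ a) (inj₂ b) (inj₂ d) (inj₂ d′) e s i = subst (λ u → S u (a (λ′ i)) (b i)) (e i) (s i)
  resp-right (inj₂ a) (inj₁ b) (inj₂ c) (inj₂ c′) e s i = subst (λ u → S (b (ρ′ i)) u (a i)) (e i) (s i)

  -- The sum of K is functional: on P^I by functionality of ⊕, and in the
  -- cases (K2), (K3) because the differences b \ a and b / a are unique
  -- by cancellation.
  functionalK : ∀ {x y z z′} → x + y ≡ z → x + y ≡ z′ → z ≈K z′
  functionalK {inj₁ a} {inj₁ b} {inj₁ c} {inj₁ c′} s t i = functional (s i) (t i)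
  functionalK {inj₁ a} {inj₂ b} {inj₂ d} {inj₂ d′} s t i = cancelʳ (s i) (t i)
  functionalK {inj₂ a} {inj₁ b} {inj₂ c} {inj₂ c′} s t i = cancelˡ (s i) (t i)

  -- In each mixed case the
  -- required element is produced coordinatewise by associativity of P;
  -- all omitted combinations have an undefined sum by (K1)-(K4).
  assoc-→K : ∀ {x y w d e} → x + y ≡ d → d + w ≡ e → ∃ λ f → y + w ≡ f × x + f ≡ e
  assoc-→K {inj₁ a} {inj₁ b} {inj₁ c} {inj₁ d} {inj₁ e} s t =
    inj₁ (λ i → proj₁ (A i)) , (λ i → proj₁ (proj₂ (A i))) , (λ i → proj₂ (proj₂ (A i)))
    where A = λ i → assoc-→ (s i) (t i)
  assoc-→K {inj₁ a} {inj₁ b} {inj₂ c} {inj₁ d} {inj₂ e} s t =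
    inj₂ (λ i → proj₁ (A i)) , (λ i → proj₂ (proj₂ (A i))) , (λ i → proj₁ (proj₂ (A i)))
    where A = λ i → assoc-← (s (λ′ i)) (t i)
  assoc-→K {inj₁ a} {inj₂ b} {inj₁ c} {inj₂ d} {inj₂ e} s t =
    inj₂ (λ i → proj₁ (A i)) , (λ i → proj₂ (proj₂ (A i))) , (λ i → proj₁ (proj₂ (A i)))
    where A = λ i → assoc-→ (t i) (s i)
  assoc-→K {inj₂ a} {inj₁ b} {inj₁ c} {inj₂ d} {inj₂ e} s t =
    inj₁ (λ j → W (ρ⁻¹ j)) ,
    (λ j → along (λ m u → S (b m) (c m) u) (ρρ⁻¹ j) (proj₁ (proj₂ (A (ρ⁻¹ j))))) ,
    (λ i → along (λ m u → S u (e m) (a m)) (ρ⁻¹ρ i) (proj₂ (proj₂ (A (ρ⁻¹ (ρ′ i))))))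
    where
      A = λ i → assoc-← (t i) (s i)
      W : I → P
      W i = proj₁ (A i)

  assoc-←K : ∀ {x y w f e} → y + w ≡ f → x + f ≡ e → ∃ λ d → x + y ≡ d × d + w ≡ e
  assoc-←K {inj₁ a} {inj₁ b} {inj₁ c} {inj₁ f} {inj₁ e} s t =
    inj₁ (λ i → proj₁ (A i)) , (λ i → proj₁ (proj₂ (A i))) , (λ i → proj₂ (proj₂ (A i)))
    where A = λ i → assoc-← (s i) (t i)
  assoc-←K {inj₂ a} {inj₁ b} {inj₁ c} {inj₁ f} {inj₂ e} s t =
    inj₂ (λ i → proj₁ (A i)) , (λ i → proj₂ (proj₂ (A i))) , (λ i → proj₁ (proj₂ (A i)))
    where A = λ i → assoc-→ (s (ρ′ i)) (t i)
  assoc-←K {inj₁ a} {inj₁ b} {inj₂ c} {inj₂ f} {inj₂ e} s t =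
    inj₁ (λ j → W (λ⁻¹ j)) ,
    (λ j → along (λ m u → S (a m) (b m) u) (λλ⁻¹ j) (proj₁ (proj₂ (A (λ⁻¹ j))))) ,
    (λ i → along (λ m u → S (e m) u (c m)) (λ⁻¹λ i) (proj₂ (proj₂ (A (λ⁻¹ (λ′ i))))))
    where
      A = λ i → assoc-→ (t i) (s i)
      W : I → P
      W i = proj₁ (A i)
  assoc-←K {inj₁ a} {inj₂ b} {inj₁ c} {inj₂ f} {inj₂ e} s t =
    inj₂ (λ i → proj₁ (A i)) , (λ i → proj₂ (proj₂ (A i))) , (λ i → proj₁ (proj₂ (A i)))
    where A = λ i → assoc-← (t i) (s i)
  -- η + η + (a_i) is undefined whichever way it is bracketed (K4).
  assoc-←K {inj₂ _} {inj₂ _} {inj₁ _} {inj₁ _} ()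
  assoc-←K {inj₂ _} {inj₂ _} {inj₁ _} {inj₂ _} _ ()

  -- (RN): the right complements x + x∼ = 1_K, and their uniqueness.
  -- Solving (K2)/(K3) against 1_K = (η 0) forces the coordinates below.
  rightComplementK : ∀ x → ∃ λ d → x + d ≡ 𝟏 × (∀ d′ → x + d′ ≡ 𝟏 → d′ ≈K d)
  rightComplementK (inj₁ a) = inj₂ (λ i → a (λ′ i)) , (λ i → identityˡ (a (λ′ i))) , unique
    where
      unique : ∀ d′ → inj₁ a + d′ ≡ 𝟏 → d′ ≈K inj₂ (λ i → a (λ′ i))
      unique (inj₂ b) s i = sym (plus-0ˡ (s i))
  rightComplementK (inj₂ a) =
    inj₁ (λ j → a (ρ⁻¹ j)) ,
    (λ i → subst (λ u → S u o (a i)) (sym (cong a (ρ⁻¹ρ i))) (identityʳ (a i))) , unique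
    where
      unique : ∀ d′ → inj₂ a + d′ ≡ 𝟏 → d′ ≈K inj₁ (λ j → a (ρ⁻¹ j))
      unique (inj₁ c) s j = begin
        c j               ≡⟨ cong c (sym (ρρ⁻¹ j)) ⟩
        c (ρ′ (ρ⁻¹ j))    ≡⟨ plus-0ʳ (s (ρ⁻¹ j)) ⟩
        a (ρ⁻¹ j)         ∎

  leftComplementK : ∀ x → ∃ λ e → e + x ≡ 𝟏 × (∀ e′ → e′ + x ≡ 𝟏 → e′ ≈K e)
  leftComplementK (inj₁ a) = inj₂ (λ i → a (ρ′ i)) , (λ i → identityʳ (a (ρ′ i))) , unique
    where
      unique : ∀ e′ → e′ + inj₁ a ≡ 𝟏 → e′ ≈K inj₂ (λ i → a (ρ′ i))
      unique (inj₂ e) s i = sym (plus-0ʳ (s i))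
  leftComplementK (inj₂ a) =
    inj₁ (λ j → a (λ⁻¹ j)) ,
    (λ i → subst (λ u → S o u (a i)) (sym (cong a (λ⁻¹λ i))) (identityˡ (a i))) , unique
    where
      unique : ∀ e′ → e′ + inj₂ a ≡ 𝟏 → e′ ≈K inj₁ (λ j → a (λ⁻¹ j))
      unique (inj₁ c) s j = begin
        c j               ≡⟨ cong c (sym (λλ⁻¹ j)) ⟩
        c (λ′ (λ⁻¹ j))    ≡⟨ plus-0ˡ (s (λ⁻¹ j)) ⟩
        a (λ⁻¹ j)         ∎

  one-leftK : ∀ {y z} → 𝟏 + y ≡ z → y ≈K inj₁ (λ _ → o)
  one-leftK {inj₁ b} {inj₂ c} s j = begin
    b j                ≡⟨ cong b (sym (ρρ⁻¹ j)) ⟩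
    b (ρ′ (ρ⁻¹ j))     ≡⟨ proj₁ (positive (s (ρ⁻¹ j))) ⟩
    o                  ∎

  one-rightK : ∀ {y z} → y + 𝟏 ≡ z → y ≈K inj₁ (λ _ → o)
  one-rightK {inj₁ a} {inj₂ d} s j = begin
    a j                ≡⟨ cong a (sym (λλ⁻¹ j)) ⟩
    a (λ′ (λ⁻¹ j))     ≡⟨ proj₂ (positive (s (λ⁻¹ j))) ⟩
    o                  ∎

  InPI : KCarrier → Set
  InPI x = ∃ λ c → x ≈K inj₁ c

  sum-closedK : ∀ {a b z} → inj₁ a + inj₁ b ≡ z → InPI z
  sum-closedK {z = inj₁ c} s = c , λ _ → refl

  no-outer-sumsK : ∀ {x y z} → (InPI x → ⊥) → (InPI y → ⊥) → x + y ≡ z → ⊥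
  no-outer-sumsK {inj₁ a} x∉ _ _ = x∉ (a , λ _ → refl)
  no-outer-sumsK {inj₂ _} {inj₁ b} _ y∉ _ = y∉ (b , λ _ → refl)

  -- Conjugation is the one axiom that needs (KCI): in the mixed cases
  -- the conjugate on one side is supplied by (KCI), on the other side by
  -- conjugation in P followed by reindexing.
  module WithKCI (kci : KCI lam rho) where

    conjugateK : ∀ {x y e} → x + y ≡ e → (∃ λ c → c + x ≡ e) × (∃ λ d → y + d ≡ e)
    conjugateK {inj₁ a} {inj₁ b} {inj₁ e} s =
      (inj₁ (λ i → proj₁ (proj₁ (conjugate (s i)))) , λ i → proj₂ (proj₁ (conjugate (s i)))) ,
      (inj₁ (λ i → proj₁ (proj₂ (conjugate (s i)))) , λ i → proj₂ (proj₂ (conjugate (s i))))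
    conjugateK {inj₁ a} {inj₂ b} {inj₂ e} s =
      (inj₂ (λ i → proj₁ (fromKCI i)) , λ i → proj₂ (fromKCI i)) ,
      (inj₁ (λ j → w (ρ⁻¹ j)) ,
       λ i → along (λ m u → S u (e m) (b m)) (ρ⁻¹ρ i) (proj₂ (proj₁ (conjugate (s (ρ⁻¹ (ρ′ i)))))))
      where
        fromKCI = λ i → Equivalence.from (kci a e i) (b i , s i)
        w : I → P
        w i = proj₁ (proj₁ (conjugate (s i)))
    conjugateK {inj₂ a} {inj₁ b} {inj₂ e} s =
      (inj₁ (λ j → w (λ⁻¹ j)) ,
       λ i → along (λ m u → S (e m) u (a m)) (λ⁻¹λ i) (proj₂ (proj₂ (conjugate (s (λ⁻¹ (λ′ i))))))) ,
      (inj₂ (λ i → proj₁ (toKCI i)) , λ i → proj₂ (toKCI i))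
      where
        toKCI = λ i → Equivalence.to (kci b e i) (a i , s i)
        w : I → P
        w i = proj₁ (proj₂ (conjugate (s i)))

    isPEA-K : IsPEA (K lam rho) 𝟏
    isPEA-K = record
      { isPartialOperation = record
          { ≈-isEquivalence = record { refl = ≈-refl ; sym = ≈-sym ; trans = ≈-trans }
          ; Sum-resp = λ {x} {x′} {y} {y′} {z} {z′} x≈ y≈ z≈ s →
              resp-right x′ y′ z z′ z≈ (resp-middle x′ y y′ z y≈ (resp-left x x′ y z x≈ s))
          ; Sum-functional = functionalK }
      ; assoc-→ = assoc-→K
      ; assoc-← = assoc-←K
      ; rightComplement = rightComplementK
      ; leftComplement = leftComplementK
      ; conjugate = conjugateK
      ; one-left = one-leftK
      ; one-right = one-rightK }

    unitization : IsUnitization PI (K lam rho) inj₁ 𝟏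
    unitization = record
      { isPEA = isPEA-K
      ; ι-resp = λ e → e
      ; ι-injective = λ e → e
      ; sum-restricts = λ _ _ _ → mk⇔ (λ s → s) (λ s → s)
      ; sum-closed = sum-closedK
      ; one∉Q = λ { (_ , ()) }
      ; no-outer-sums = no-outer-sumsK }

    private
      _⁻K _∼K : KCarrier → KCarrier
      _⁻K = _⁻ (K lam rho) isPEA-K
      _∼K = _∼ (K lam rho) isPEA-K

    left-negation-P : ∀ a → (inj₁ a ⁻K) ≈K inj₂ (λ i → a (ρ′ i))
    left-negation-P _ _ = refl

    left-negation-η : ∀ a → (inj₂ a ⁻K) ≈K inj₁ (λ i → a (λ⁻¹ i))
    left-negation-η _ _ = refl

    right-negation-P : ∀ a → (inj₁ a ∼K) ≈K inj₂ (λ i → a (λ′ i))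
    right-negation-P _ _ = refl

    right-negation-η : ∀ a → (inj₂ a ∼K) ≈K inj₁ (λ i → a (ρ⁻¹ i))
    right-negation-η _ _ = refl

    double-negation : ∀ a → ((inj₁ a ⁻K) ⁻K) ≈K inj₁ (λ i → a (ρ′ (λ⁻¹ i)))
    double-negation _ _ = refl

    unitizing-is-γ : ∀ a → IsUnitization.unitizing unitization (inj₁ a) ≈K inj₁ (γ lam rho a)
    unitizing-is-γ _ _ = refl

corollary3p10 : (P : Set) (S : P → P → P → Set) (o : P) → IsGPEA (mkPA P S o) →
    (I : Set) (lam rho : I ↔ I) → Kite.KCI P S o I lam rho →
    Σ (IsUnitization (Kite.PI P S o I) (Kite.K P S o I lam rho) inj₁ (Kite.oneK P S o I lam rho))
      (λ U →
        let KA  = Kite.K P S o I lam rho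
            pea = IsUnitization.isPEA U
            _≈_ = Kite._≈K_ P S o I
        in
        ((a : I → P) → _⁻ KA pea (inj₁ a) ≈ inj₂ (λ i → a (Inverse.to rho i))) ×
        ((a : I → P) → _⁻ KA pea (inj₂ a) ≈ inj₁ (λ i → a (Inverse.from lam i))) ×
        ((a : I → P) → _∼ KA pea (inj₁ a) ≈ inj₂ (λ i → a (Inverse.to lam i))) ×
        ((a : I → P) → _∼ KA pea (inj₂ a) ≈ inj₁ (λ i → a (Inverse.from rho i))) ×
        ((a : I → P) → _⁻ KA pea (_⁻ KA pea (inj₁ a))
                         ≈ inj₁ (λ i → a (Inverse.to rho (Inverse.from lam i)))) ×
        ((a : I → P) → IsUnitization.unitizing U (inj₁ a) ≈ inj₁ (Kite.γ P S o I lam rho a)))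
corollary3p10 P S o G I lam rho kci =
  unitization ,
  left-negation-P , left-negation-η ,
  right-negation-P , right-negation-η ,
  double-negation , unitizing-is-γ
  where open KiteAlgebra P S o G I lam rho
        open WithKCI kci
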